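{- Let $\mathbf A,\mathbf B$ be finite algebras in $\mathcal V_3$ such that $\mathbf A$ is Jónsson trivial and connected with respect to some subdirect subalgebra $\mathbf S$ of $\mathbf A\times\mathbf B$. Then $d(a,b)\le1$ for all $a,b\in A$ (equivalently, $S_1=A^2$).
   Context: $\mathcal V_3$ is the class of algebras $(A;p_0,p_1,p_2,p_3)$ with ternary basic operations satisfying $p_0(x,y,z)=x$, $p_3(x,y,z)=z$, $p_i(x,y,x)=x$ for all $i$, $p_0(x,x,y)=p_1(x,x,y)$, $p_2(x,x,y)=p_3(x,x,y)$, $p_1(x,y,y)=p_2(x,y,y)$; $x\cdot y=p_1(x,y,y)$. A Jónsson ideal of $\mathbf A$ is a subuniverse $Y$ with $u\cdot y\in Y$ for all $y\in Y,u\in A$; a finite $\mathbf A\in\mathcal V_3$ is Jónsson trivial if its only Jónsson ideals are $\emptyset$ and $A$. Distance relative to $\mathbf S$: $S_0=0_A$, $S_1=\{(a,c):\exists b\in B,(a,b),(c,b)\in S\}$, $S_{k+1}=S_k\circ S_1$; $d(a,b)$ is the least $k$ with $(a,b)\in S_k$ (undefined if none); connected means $d$ is everywhere defined. -}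

module Defs where

open import Data.Nat using (ℕ; zero; suc)
open import Data.Fin using (Fin; zero; suc)
open import Data.Fin.Subset using (Subset; _∈_; ⊥; ⊤)
open import Data.Bool using (Bool; T)
open import Data.Product using (Σ; _×_; ∃-syntax)
open import Data.Sum using (_⊎_)
open import Relation.Binary.PropositionalEquality using (_≡_)

i0 i1 i2 i3 : Fin 4
i0 = zero
i1 = suc zero
i2 = suc (suc zero)
i3 = suc (suc (suc zero))

record V3Alg (n : ℕ) : Set where
  field
    p : Fin 4 → Fin n → Fin n → Fin n → Fin n
    ax0   : ∀ x y z → p i0 x y z ≡ x
    ax3   : ∀ x y z → p i3 x y z ≡ z
    axxyx : ∀ i x y → p i x y x ≡ x
    ax01  : ∀ x y → p i0 x x y ≡ p i1 x x y
    ax23  : ∀ x y → p i2 x x y ≡ p i3 x x y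
    ax12  : ∀ x y → p i1 x y y ≡ p i2 x y y

module _ {n : ℕ} (A : V3Alg n) where
  open V3Alg A

  dot : Fin n → Fin n → Fin n
  dot x y = p i1 x y y

  IsSubuniverse : Subset n → Set
  IsSubuniverse Y = ∀ i x y z → x ∈ Y → y ∈ Y → z ∈ Y → p i x y z ∈ Y

  IsJonssonIdeal : Subset n → Set
  IsJonssonIdeal Y = IsSubuniverse Y × (∀ u y → y ∈ Y → dot u y ∈ Y)

  JonssonTrivial : Set
  JonssonTrivial = ∀ Y → IsJonssonIdeal Y → (Y ≡ ⊥) ⊎ (Y ≡ ⊤)

module _ {n m : ℕ} (A : V3Alg n) (B : V3Alg m) (S : Fin n → Fin m → Bool) where
  private
    module A = V3Alg A
    module B = V3Alg B

  IsSubalgebraOfProduct : Set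
  IsSubalgebraOfProduct =
    ∀ i a₁ a₂ a₃ b₁ b₂ b₃ → T (S a₁ b₁) → T (S a₂ b₂) → T (S a₃ b₃) →
      T (S (A.p i a₁ a₂ a₃) (B.p i b₁ b₂ b₃))

  IsSubdirect : Set
  IsSubdirect = IsSubalgebraOfProduct
              × (∀ a → ∃[ b ] T (S a b))
              × (∀ b → ∃[ a ] T (S a b))

module _ {n m : ℕ} (S : Fin n → Fin m → Bool) where

  S₁ : Fin n → Fin n → Set
  S₁ a c = ∃[ b ] (T (S a b) × T (S c b))

  SRel : ℕ → Fin n → Fin n → Set
  SRel zero a c = a ≡ c
  SRel (suc k) a c = ∃[ e ] (SRel k a e × S₁ e c)

  -- d is everywhere defined
  Connected : Set
  Connected = ∀ a c → ∃[ k ] SRel k a c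

module Submission where

-- Let Q be a reflexive compatible relation on a Jónsson trivial algebra A in which
-- any two elements have a common Q-neighbour. For a ∈ A the set of y whose
-- Q-neighbours include all those of a is a subuniverse containing a, and it absorbs
-- u · y = p₂(u,y,y): take a common neighbour l of a and u and apply p₂ to
-- (u,l), (y,l), (y,e), using p₂(l,l,e) = e. So it is all of A and Q is total.
-- The powers S₁^k are reflexive, symmetric and compatible; by finiteness and
-- connectedness some S₁^K is total, and if S₁^(k+2) is total then S₁^(k+1) has
-- common neighbours, so the totality descends to S₁ = S_1.

open import Defs
open import Data.Nat using (ℕ; zero; suc; _≤_; _≤′_; ≤′-refl; ≤′-step; _⊔_; z≤n; s≤s)
open import Data.Nat.Properties using (≤⇒≤′; m≤m⊔n; m≤n⊔m)
open import Data.Fin as Fin using (Fin; _≟_)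
open import Data.Fin.Properties using (any?; all?)
open import Data.Fin.Subset using (Subset; _∈_)
open import Data.Fin.Subset.Properties using (∉⊥; ∈⊤)
open import Data.Bool using (Bool; T)
open import Data.Product using (_×_; ∃-syntax; _,_)
open import Data.Sum using (inj₁; inj₂)
open import Data.Vec using (tabulate)
open import Data.Vec.Properties using (lookup∘tabulate; []=⇒lookup; lookup⇒[]=)
open import Function using (_∘_; id)
open import Level using (0ℓ)
open import Relation.Binary.Core using (Rel; _⇒_)
open import Relation.Binary.Definitions using (Reflexive; Symmetric; Decidable)
open import Relation.Binary.PropositionalEquality using (_≡_; refl; sym; trans; subst; subst₂)
open import Relation.Nullary using (yes; no; does; contradiction)
open import Relation.Nullary.Decidable using (T?; _×-dec_; _→-dec_; dec-true)
open import Relation.Unary as U using (Pred)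

module _ {n : ℕ} {P : Pred (Fin n) 0ℓ} (P? : U.Decidable P) where

  decSubset : Subset n
  decSubset = tabulate (does ∘ P?)

  ∈-decSubset⁺ : ∀ {y} → P y → y ∈ decSubset
  ∈-decSubset⁺ {y} py = lookup⇒[]= y decSubset (trans (lookup∘tabulate _ y) (dec-true (P? y) py))

  ∈-decSubset⁻ : ∀ {y} → y ∈ decSubset → P y
  ∈-decSubset⁻ {y} y∈ with P? y | trans (sym (lookup∘tabulate (does ∘ P?) y)) ([]=⇒lookup y∈)
  ... | yes py | _ = py
  ... | no _   | ()

-- Composed on the right, matching the recursion S_{k+1} = S_k ∘ S_1.

_^_ : ∀ {X : Set} → Rel X 0ℓ → ℕ → Rel X 0ℓ
(R ^ zero)  a c = a ≡ c
(R ^ suc k) a c = ∃[ e ] ((R ^ k) a e × R e c)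

module _ {X : Set} {R : Rel X 0ℓ} (refl-R : Reflexive R) where

  ^-refl : ∀ k → Reflexive (R ^ k)
  ^-refl zero    = refl
  ^-refl (suc k) = _ , ^-refl k , refl-R

  ^-step : ∀ {k} → R ^ k ⇒ R ^ suc k
  ^-step r = _ , r , refl-R

  ⊆-^-suc : ∀ k → R ⇒ R ^ suc k
  ⊆-^-suc k r = _ , ^-refl k , r

^-dec : ∀ {n} {R : Rel (Fin n) 0ℓ} → Decidable R → ∀ k → Decidable (R ^ k)
^-dec R? zero    a c = a ≟ c
^-dec R? (suc k) a c = any? (λ e → ^-dec R? k a e ×-dec R? e c)

SRel⇒^ : ∀ {n m} (S : Fin n → Fin m → Bool) k {a c} → SRel S k a c → (S₁ S ^ k) a c
SRel⇒^ S zero    a≡c           = a≡c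
SRel⇒^ S (suc k) (e , sk , s₁) = e , SRel⇒^ S k sk , s₁

module _ {n : ℕ} (A : V3Alg n) where
  open V3Alg A

  Compatible : Rel (Fin n) 0ℓ → Set
  Compatible Q = ∀ i {x₁ x₂ x₃ y₁ y₂ y₃} → Q x₁ y₁ → Q x₂ y₂ → Q x₃ y₃
               → Q (p i x₁ x₂ x₃) (p i y₁ y₂ y₃)

  ^-compatible : ∀ {R} → Compatible R → ∀ k → Compatible (R ^ k)
  ^-compatible cR zero    i refl refl refl = refl
  ^-compatible cR (suc k) i (e₁ , q₁ , r₁) (e₂ , q₂ , r₂) (e₃ , q₃ , r₃) =
    p i e₁ e₂ e₃ , ^-compatible cR k i q₁ q₂ q₃ , cR i r₁ r₂ r₃

module _ {n : ℕ} (A : V3Alg n) (jt : JonssonTrivial A) where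
  open V3Alg A

  common-neighbour⇒total : ∀ {Q : Rel (Fin n) 0ℓ} → Decidable Q → Reflexive Q → Compatible A Q
                         → (∀ a u → ∃[ l ] (Q a l × Q u l)) → ∀ y a → Q y a
  common-neighbour⇒total {Q} Q? refl-Q cQ common y a = ∈-decSubset⁻ covers? y∈Y a refl-Q
    where
      Covers : Pred (Fin n) 0ℓ
      Covers y = ∀ e → Q a e → Q y e

      covers? : U.Decidable Covers
      covers? y = all? (λ e → Q? a e →-dec Q? y e)

      Y : Subset n
      Y = decSubset covers?

      Y-subuniverse : IsSubuniverse A Y
      Y-subuniverse i x₁ x₂ x₃ x₁∈Y x₂∈Y x₃∈Y = ∈-decSubset⁺ covers? λ e qae →
        subst (Q (p i x₁ x₂ x₃)) (axxyx i e e)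
          (cQ i (∈-decSubset⁻ covers? x₁∈Y e qae) (∈-decSubset⁻ covers? x₂∈Y e qae)
                (∈-decSubset⁻ covers? x₃∈Y e qae))

      Y-absorbing : ∀ u y → y ∈ Y → dot A u y ∈ Y
      Y-absorbing u y y∈Y = ∈-decSubset⁺ covers? λ e qae →
        let l , qal , qul = common a u in
        subst₂ Q (sym (ax12 u y)) (trans (ax23 l e) (ax3 l l e))
          (cQ i2 qul (∈-decSubset⁻ covers? y∈Y l qal) (∈-decSubset⁻ covers? y∈Y e qae))

      a∈Y : a ∈ Y
      a∈Y = ∈-decSubset⁺ covers? λ _ qae → qae

      y∈Y : y ∈ Y
      y∈Y with jt Y (Y-subuniverse , Y-absorbing)
      ... | inj₁ Y≡∅ = contradiction (subst (a ∈_) Y≡∅ a∈Y) ∉⊥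
      ... | inj₂ Y≡A = subst (y ∈_) (sym Y≡A) ∈⊤

  ^-total⇒total : ∀ {R : Rel (Fin n) 0ℓ} → Decidable R → Reflexive R → Symmetric R → Compatible A R
                → ∀ k → (∀ a c → (R ^ k) a c) → ∀ a c → R a c
  ^-total⇒total {R} R? refl-R sym-R cR zero total a c = subst (R a) (total a c) refl-R
  ^-total⇒total R? refl-R sym-R cR (suc zero) total a c with total a c
  ... | _ , refl , r = r
  ^-total⇒total {R} R? refl-R sym-R cR (suc (suc k)) total =
    ^-total⇒total R? refl-R sym-R cR (suc k)
      (common-neighbour⇒total (^-dec R? (suc k)) (^-refl refl-R (suc k)) (^-compatible A cR (suc k)) common)
    where
      common : ∀ a u → ∃[ l ] ((R ^ suc k) a l × (R ^ suc k) u l)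
      common a u = let e , q , r = total a u in e , q , ⊆-^-suc refl-R k (sym-R r)

uniform-bound : ∀ {n} (P : ℕ → Fin n → Set) → (∀ {k} i → P k i → P (suc k) i)
              → (∀ i → ∃[ k ] P k i) → ∃[ K ] (∀ i → P K i)
uniform-bound {zero}  P step bounded = zero , λ ()
uniform-bound {suc n} P step bounded =
  let k₀ , p₀ = bounded Fin.zero
      K , ps  = uniform-bound (λ k i → P k (Fin.suc i)) (step ∘ Fin.suc) (bounded ∘ Fin.suc)
  in k₀ ⊔ K , λ { Fin.zero    → raise Fin.zero (m≤m⊔n k₀ K) p₀
                ; (Fin.suc i) → raise (Fin.suc i) (m≤n⊔m k₀ K) (ps i) }
  where
    raise′ : ∀ {j k} i → j ≤′ k → P j i → P k i
    raise′ i ≤′-refl        = id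
    raise′ i (≤′-step j≤′k) = step i ∘ raise′ i j≤′k

    raise : ∀ {j k} i → j ≤ k → P j i → P k i
    raise i = raise′ i ∘ ≤⇒≤′

module _ {n m : ℕ} (S : Fin n → Fin m → Bool) where

  S₁-dec : Decidable (S₁ S)
  S₁-dec a c = any? (λ b → T? (S a b) ×-dec T? (S c b))

  S₁-sym : Symmetric (S₁ S)
  S₁-sym (b , sab , scb) = b , scb , sab

  S₁-refl : (∀ a → ∃[ b ] T (S a b)) → Reflexive (S₁ S)
  S₁-refl left-total {a} = let b , sab = left-total a in b , sab , sab

  S₁-compatible : (A : V3Alg n) (B : V3Alg m) → IsSubalgebraOfProduct A B S → Compatible A (S₁ S)
  S₁-compatible A B sub i (b₁ , s₁ , t₁) (b₂ , s₂ , t₂) (b₃ , s₃ , t₃) =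
    V3Alg.p B i b₁ b₂ b₃ , sub i _ _ _ b₁ b₂ b₃ s₁ s₂ s₃ , sub i _ _ _ b₁ b₂ b₃ t₁ t₂ t₃

  connected⇒^-total : Reflexive (S₁ S) → Connected S → ∃[ K ] (∀ a c → (S₁ S ^ K) a c)
  connected⇒^-total refl₁ conn =
    uniform-bound (λ k a → ∀ c → (S₁ S ^ k) a c) (λ a total c → ^-step refl₁ (total c)) λ a →
      uniform-bound (λ k c → (S₁ S ^ k) a c) (λ c → ^-step refl₁) λ c →
        let k , sk = conn a c in k , SRel⇒^ S k sk

corollary3p7 : ∀ {n m : ℕ} (A : V3Alg n) (B : V3Alg m) (S : Fin n → Fin m → Bool)
    → IsSubdirect A B S → JonssonTrivial A → Connected S
    → ∀ a c → ∃[ k ] (k ≤ 1 × SRel S k a c)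
corollary3p7 A B S (sub , left-total , _) jt conn a c =
  let refl₁     = S₁-refl S left-total
      K , total = connected⇒^-total S refl₁ conn
  in 1 , s≤s z≤n , a , refl ,
     ^-total⇒total A jt (S₁-dec S) refl₁ (S₁-sym S) (S₁-compatible S A B sub) K total a c
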